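{- Let $G$ be a bipartite graph of order $n(G)$ with $l$ pendant vertices. Then $l\le sn(G,3)\le n(G)$. Moreover, (i) $sn(G,3)=n(G)$ if and only if $G$ is $K_1$ or $K_2$; (ii) $sn(G,3)=n(G)-1$ if and only if $G$ is a star $K_{1,r}$ (for some $r$) or the path $P_4$.
   Context: All graphs are finite, simple, undirected and connected. Let $G=(V,E)$ be a graph with chromatic number $\chi(G)$, let $k\ge\chi(G)$ and $S\subseteq V$. A proper $k$-coloring $C_0$ of the induced subgraph $G[S]$ is extendable if it extends to a proper $k$-coloring of $G$, and is a $k$-Sudoku coloring if it extends to exactly one proper $k$-coloring of $G$. The $k$-Sudoku number $sn(G,k)$ is the smallest $|S|$ such that $G[S]$ admits a $k$-Sudoku coloring. -}

module Defs where

open import Data.Nat using (ℕ; zero; suc; _+_; _≡ᵇ_)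
open import Data.Fin using (Fin; zero; suc; toℕ)
open import Data.Bool using (Bool; true; false; if_then_else_)
open import Data.Product using (Σ; _×_; _,_)
open import Function using (_∘_)
open import Function.Bundles using (_↔_; Inverse)
open import Relation.Binary.PropositionalEquality using (_≡_; _≢_)

count : ∀ {n} → (Fin n → Bool) → ℕ
count {zero}  p = 0
count {suc n} p = (if p zero then 1 else 0) + count (p ∘ suc)

record Graph (n : ℕ) : Set where
  field
    adj    : Fin n → Fin n → Bool
    sym    : ∀ u v → adj u v ≡ adj v u
    irrefl : ∀ u → adj u u ≡ false
open Graph public

Adj : ∀ {n} → Graph n → Fin n → Fin n → Set
Adj G u v = adj G u v ≡ true

data Reach {n} (G : Graph n) : Fin n → Fin n → Set where
  here : ∀ {u} → Reach G u u
  step : ∀ {u w v} → Adj G u w → Reach G w v → Reach G u v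

Connected : ∀ {n} → Graph n → Set
Connected G = ∀ u v → Reach G u v

Bipartite : ∀ {n} → Graph n → Set
Bipartite {n} G = Σ (Fin n → Bool) λ side → ∀ u v → Adj G u v → side u ≢ side v

degree : ∀ {n} → Graph n → Fin n → ℕ
degree G u = count (adj G u)

pendantCount : ∀ {n} → Graph n → ℕ
pendantCount G = count (λ u → degree G u ≡ᵇ 1)

Proper : ∀ {n k} → Graph n → (Fin n → Fin k) → Set
Proper G c = ∀ u v → Adj G u v → c u ≢ c v

ProperOn : ∀ {n k} → Graph n → (Fin n → Bool) → (Fin n → Fin k) → Set
ProperOn G S c₀ = ∀ u v → S u ≡ true → S v ≡ true → Adj G u v → c₀ u ≢ c₀ v

Extends : ∀ {n k} → (Fin n → Bool) → (Fin n → Fin k) → (Fin n → Fin k) → Set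
Extends S c₀ c = ∀ u → S u ≡ true → c u ≡ c₀ u

SudokuColoring : ∀ {n} → Graph n → (k : ℕ) → (Fin n → Bool) → (Fin n → Fin k) → Set
SudokuColoring G k S c₀ =
  ProperOn G S c₀ ×
  Σ (Fin _ → Fin k) (λ c → Proper G c × Extends S c₀ c ×
     (∀ c' → Proper G c' → Extends S c₀ c' → ∀ u → c' u ≡ c u))

HasSudoku : ∀ {n} → Graph n → (k : ℕ) → (Fin n → Bool) → Set
HasSudoku {n} G k S = Σ (Fin n → Fin k) λ c₀ → SudokuColoring G k S c₀

IsSudokuNumber : ∀ {n} → Graph n → (k : ℕ) → ℕ → Set
IsSudokuNumber {n} G k m =
  Σ (Fin n → Bool) (λ S → count S ≡ m × HasSudoku G k S) ×
  (∀ S → HasSudoku G k S → m Data.Nat.≤ count S)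

Iso : ∀ {n m} → Graph n → Graph m → Set
Iso {n} {m} G H = Σ (Fin n ↔ Fin m) λ f →
  ∀ u v → adj H (Inverse.to f u) (Inverse.to f v) ≡ adj G u v

complete : (n : ℕ) → Graph n
complete n = record { adj = λ u v → Data.Bool.not (toℕ u ≡ᵇ toℕ v)
                    ; sym = λ u v → Eq.cong Data.Bool.not (ℕP.≡ᵇ-sym (toℕ u) (toℕ v))
                    ; irrefl = λ u → Eq.cong Data.Bool.not (ℕP.≡ᵇ-refl (toℕ u)) }
  where
  import Relation.Binary.PropositionalEquality as Eq
  module ℕP where
    ≡ᵇ-refl : ∀ a → (a ≡ᵇ a) ≡ true
    ≡ᵇ-refl zero = Eq.refl
    ≡ᵇ-refl (suc a) = ≡ᵇ-refl a
    ≡ᵇ-sym : ∀ a b → (a ≡ᵇ b) ≡ (b ≡ᵇ a)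
    ≡ᵇ-sym zero zero = Eq.refl
    ≡ᵇ-sym zero (suc b) = Eq.refl
    ≡ᵇ-sym (suc a) zero = Eq.refl
    ≡ᵇ-sym (suc a) (suc b) = ≡ᵇ-sym a b

starAdj : ∀ {r} → Fin (suc r) → Fin (suc r) → Bool
starAdj zero    zero    = false
starAdj zero    (suc _) = true
starAdj (suc _) zero    = true
starAdj (suc _) (suc _) = false

star : (r : ℕ) → Graph (suc r)
star r = record { adj = starAdj ; sym = s ; irrefl = i }
  where
  import Relation.Binary.PropositionalEquality as Eq
  s : ∀ u v → starAdj u v ≡ starAdj v u
  s zero zero = Eq.refl
  s zero (suc _) = Eq.refl
  s (suc _) zero = Eq.refl
  s (suc _) (suc _) = Eq.refl
  i : ∀ u → starAdj u u ≡ false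
  i zero = Eq.refl
  i (suc _) = Eq.refl

pathAdj : Fin 4 → Fin 4 → Bool
pathAdj u v = (suc (toℕ u) ≡ᵇ toℕ v) Data.Bool.∨ (suc (toℕ v) ≡ᵇ toℕ u)

P4 : Graph 4
P4 = record { adj = pathAdj ; sym = s ; irrefl = i }
  where
  import Relation.Binary.PropositionalEquality as Eq
  s : ∀ u v → pathAdj u v ≡ pathAdj v u
  s u v = Data.Bool.Properties.∨-comm (suc (toℕ u) ≡ᵇ toℕ v) (suc (toℕ v) ≡ᵇ toℕ u)
    where import Data.Bool.Properties
  i : ∀ u → pathAdj u u ≡ false
  i zero = Eq.refl
  i (suc zero) = Eq.refl
  i (suc (suc zero)) = Eq.refl
  i (suc (suc (suc zero))) = Eq.refl

{-# OPTIONS --safe #-}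
-- In a 3-Sudoku colouring an uncoloured vertex must see two different colours among its
-- neighbours, for otherwise it could be recoloured; so it has two neighbours, and every vertex of
-- degree at most one, in particular every pendant vertex, is coloured. Conversely, in a bipartite
-- graph colour one side 0 and the other side 1 or 2: a vertex whose neighbours get both 1 and 2 is
-- forced, so one vertex with two neighbours may be left uncoloured, and so may two such vertices on
-- the same side, or two adjacent ones x, y when x has two neighbours other than y, one of them a
-- leaf that is then recoloured. What remains are the connected bipartite graphs with no vertex of
-- degree at least two (K₁, K₂), exactly one (stars), or exactly two, adjacent and both of degree
-- two (P₄); in P₄ the two inner vertices cannot both be uncoloured, since swapping their colours
-- would give a second extension.
module Submission where

open import Defs hiding (sym)
open import Data.Bool as Bool using (Bool; true; false; not; _∨_; if_then_else_)
open import Data.Bool.Properties using (¬-not; ∨-zeroʳ)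
open import Data.Empty using (⊥; ⊥-elim)
open import Data.Fin using (Fin; zero; suc; _≟_)
open import Data.Fin.Permutation using (transpose)
open import Data.Fin.Permutation.Components as PC using (transpose-inverse)
open import Data.Fin.Properties using (any?; all?)
open import Data.Nat using (ℕ; zero; suc; _+_; _∸_; _≤_; _<_; _≥_; z≤n; s≤s; _≡ᵇ_)
open import Data.Nat.Properties
  using (≤-trans; ≤-antisym; m≤n+m; n≤1+n; 1+n≰n; 1+n≢n; +-suc; m+n∸m≡n; m+n∸n≡m; ∸-monoʳ-≤;
         module ≤-Reasoning)
open import Data.Product using (Σ; ∃; _×_; _,_; proj₁; proj₂)
open import Data.Sum using (_⊎_; inj₁; inj₂; [_,_]′)
open import Data.Vec using (Vec; []; _∷_; lookup)
open import Data.Vec.Functional using (updateAt)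
open import Data.Vec.Functional.Properties using (updateAt-updates; updateAt-minimal)
open import Data.Vec.Membership.Propositional using (_∈_)
open import Data.Vec.Relation.Unary.All using ([]; _∷_)
open import Data.Vec.Relation.Unary.AllPairs using ([]; _∷_)
open import Data.Vec.Relation.Unary.Any as Any using (here; there)
open import Data.Vec.Relation.Unary.Any.Properties using (lookup-index)
open import Data.Vec.Relation.Unary.Unique.Propositional using (Unique)
open import Data.Vec.Relation.Unary.Unique.Propositional.Properties using (lookup-injective)
open import Function using (_∘_; id; const; case_of_)
open import Function.Bundles using (Inverse; mk↔ₛ′; _⇔_; mk⇔)
open import Relation.Binary.PropositionalEquality
  using (_≡_; _≢_; refl; sym; trans; cong; cong₂; subst; ≢-sym; module ≡-Reasoning)
open import Relation.Nullary using (¬_; Dec; yes; no; does)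
open import Relation.Nullary.Decidable
  using (dec-true; dec-false; from-yes; decidable-stable; ¬?; _×-dec_; _→-dec_)

-- Vertex sets and counting

_==_ : ∀ {n} → Fin n → Fin n → Bool
i == j = does (i ≟ j)

==-refl : ∀ {n} (i : Fin n) → (i == i) ≡ true
==-refl i = dec-true (i ≟ i) refl

==-≢ : ∀ {n} {i j : Fin n} → i ≢ j → (i == j) ≡ false
==-≢ {i = i} {j} = dec-false (i ≟ j)

==⇒≡ : ∀ {n} {i j : Fin n} → (i == j) ≡ true → i ≡ j
==⇒≡ {i = i} {j} eq with i ≟ j
... | yes i≡j = i≡j

count-mono : ∀ {n} {p q : Fin n → Bool} → (∀ i → p i ≡ true → q i ≡ true) → count p ≤ count q
count-mono {zero} p⊆q = z≤n
count-mono {suc n} {p} {q} p⊆q with p zero in p₀ | q zero in q₀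
... | true  | true  = s≤s (count-mono (p⊆q ∘ suc))
... | false | true  = ≤-trans (count-mono {n} (p⊆q ∘ suc)) (m≤n+m _ 1)
... | false | false = count-mono (p⊆q ∘ suc)
... | true  | false with () ← trans (sym (p⊆q zero p₀)) q₀

count≤n : ∀ {n} (p : Fin n → Bool) → count p ≤ n
count≤n {zero} p = z≤n
count≤n {suc n} p with p zero
... | true  = s≤s (count≤n (p ∘ suc))
... | false = ≤-trans (count≤n (p ∘ suc)) (m≤n+m n 1)

count-false : ∀ {n} → count {n} (const false) ≡ 0
count-false {zero}  = refl
count-false {suc n} = count-false {n}

count-+-not : ∀ {n} (p : Fin n → Bool) → count p + count (not ∘ p) ≡ n
count-+-not {zero} p = refl
count-+-not {suc n} p with p zero
... | true  = cong suc (count-+-not (p ∘ suc))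
... | false = trans (+-suc (count (p ∘ suc)) _) (cong suc (count-+-not (p ∘ suc)))

count-not : ∀ {n} (p : Fin n → Bool) → count (not ∘ p) ≡ n ∸ count p
count-not {n} p = trans (sym (m+n∸m≡n (count p) _)) (cong (_∸ count p) (count-+-not p))

count-∨ : ∀ {n} (p q : Fin n → Bool) → (∀ i → p i ≡ true → q i ≡ false) →
  count (λ i → p i ∨ q i) ≡ count p + count q
count-∨ {zero} p q disjoint = refl
count-∨ {suc n} p q disjoint with p zero in p₀ | q zero in q₀
... | true  | true with () ← trans (sym q₀) (disjoint zero p₀)
... | true  | false = cong suc (count-∨ (p ∘ suc) (q ∘ suc) (disjoint ∘ suc))
... | false | true  = trans (cong suc (count-∨ (p ∘ suc) (q ∘ suc) (disjoint ∘ suc)))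
                            (sym (+-suc (count (p ∘ suc)) _))
... | false | false = count-∨ (p ∘ suc) (q ∘ suc) (disjoint ∘ suc)

count-== : ∀ {n} (x : Fin n) → count (_== x) ≡ 1
count-== {suc n} zero    = cong suc (count-false {n})
count-== {suc n} (suc x) = count-== x

count-pair : ∀ {n} {x y : Fin n} → x ≢ y → count (λ i → (i == x) ∨ (i == y)) ≡ 2
count-pair {x = x} {y} x≢y = begin
  count (λ i → (i == x) ∨ (i == y))  ≡⟨ count-∨ (_== x) (_== y) disjoint ⟩
  count (_== x) + count (_== y)      ≡⟨ cong₂ _+_ (count-== x) (count-== y) ⟩
  2                                  ∎
  where
  open ≡-Reasoning
  disjoint : ∀ i → (i == x) ≡ true → (i == y) ≡ false
  disjoint i i==x = ==-≢ (λ i≡y → x≢y (trans (sym (==⇒≡ {i = i} i==x)) i≡y))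

2≤count : ∀ {n} (p : Fin n → Bool) {x y : Fin n} → x ≢ y → p x ≡ true → p y ≡ true → 2 ≤ count p
2≤count p {x} {y} x≢y px py = subst (_≤ count p) (count-pair x≢y) (count-mono pair⊆p)
  where
  pair⊆p : ∀ i → ((i == x) ∨ (i == y)) ≡ true → p i ≡ true
  pair⊆p i _ with i ≟ x | i ≟ y
  pair⊆p i _  | yes refl | _        = px
  pair⊆p i _  | no _     | yes refl = py
  pair⊆p i () | no _     | no _

count-cover : ∀ {n} (S T : Fin n → Bool) → (∀ i → S i ≡ false → T i ≡ true) →
  n ∸ count T ≤ count S
count-cover {n} S T cover = begin
  n ∸ count T                        ≤⟨ ∸-monoʳ-≤ n (count-mono outside⊆T) ⟩
  n ∸ count (not ∘ S)                ≡⟨ cong (_∸ count (not ∘ S)) (sym (count-+-not S)) ⟩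
  count S + count (not ∘ S) ∸ count (not ∘ S) ≡⟨ m+n∸n≡m (count S) (count (not ∘ S)) ⟩
  count S                            ∎
  where
  open ≤-Reasoning
  outside⊆T : ∀ i → not (S i) ≡ true → T i ≡ true
  outside⊆T i _ with S i in Sᵢ
  outside⊆T i _ | false = cover i Sᵢ

==-separates : ∀ {n} {u w : Fin n} → u ≢ w → (u == u) ≢ (w == u)
==-separates {u = u} u≢w rewrite ==-refl u | ==-≢ (≢-sym u≢w) = λ ()

allBut : ∀ {n} → Fin n → Fin n → Bool
allBut x v = not (v == x)

allBut₂ : ∀ {n} → Fin n → Fin n → Fin n → Bool
allBut₂ x y v = not ((v == x) ∨ (v == y))

count-allBut : ∀ {n} (x : Fin n) → count (allBut x) ≡ n ∸ 1
count-allBut {n} x = trans (count-not (_== x)) (cong (n ∸_) (count-== x))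

count-allBut₂ : ∀ {n} {x y : Fin n} → x ≢ y → count (allBut₂ x y) ≡ n ∸ 2
count-allBut₂ {n} {x} {y} x≢y =
  trans (count-not (λ v → (v == x) ∨ (v == y))) (cong (n ∸_) (count-pair x≢y))

allBut-∋ : ∀ {n} {x v : Fin n} → v ≢ x → allBut x v ≡ true
allBut-∋ v≢x rewrite ==-≢ v≢x = refl

allBut-∌ : ∀ {n} (x v : Fin n) → allBut x v ≡ false → v ≡ x
allBut-∌ x v v∉ with v ≟ x
... | yes v≡x = v≡x

allBut₂-∋ : ∀ {n} {x y v : Fin n} → v ≢ x → v ≢ y → allBut₂ x y v ≡ true
allBut₂-∋ v≢x v≢y rewrite ==-≢ v≢x | ==-≢ v≢y = refl

allBut₂-∌ : ∀ {n} (x y v : Fin n) → allBut₂ x y v ≡ false → v ≡ x ⊎ v ≡ y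
allBut₂-∌ x y v v∉ with v ≟ x | v ≟ y
... | yes v≡x | _       = inj₁ v≡x
... | no _    | yes v≡y = inj₂ v≡y

mark-separates : ∀ {n} {p q a b : Fin n} → p ≢ q → a ≢ b → a ≢ q → b ≢ p →
  let T = λ v → (v == p) ∨ (v == a) in T p ≢ T q × T a ≢ T b
mark-separates {p = p} {q} {a} {b} p≢q a≢b a≢q b≢p
  rewrite ==-refl p | ==-refl a | ==-≢ (≢-sym p≢q) | ==-≢ (≢-sym a≢q) | ==-≢ b≢p
        | ==-≢ (≢-sym a≢b) | ∨-zeroʳ (a == p) = (λ ()) , (λ ())

-- T marks p and one of u, w, chosen so that neither q nor the other one of u, w is marked.
separating : ∀ {n} {p q u w : Fin n} → p ≢ q → u ≢ w →
  Σ (Fin n → Bool) λ T → T p ≢ T q × T u ≢ T w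
separating {p = p} {q} {u} {w} p≢q u≢w with u ≟ q | w ≟ p
... | no u≢q | no w≢p = _ , mark-separates p≢q u≢w u≢q w≢p
... | yes u≡q | _ with mark-separates p≢q (≢-sym u≢w) (λ w≡q → u≢w (trans u≡q (sym w≡q)))
                                       (λ u≡p → p≢q (trans (sym u≡p) u≡q))
...   | Tp≢Tq , Tw≢Tu = _ , Tp≢Tq , ≢-sym Tw≢Tu
separating {p = p} {q} {u} {w} p≢q u≢w | no _ | yes w≡p
  with mark-separates p≢q (≢-sym u≢w) (λ w≡q → p≢q (trans (sym w≡p) w≡q))
                                       (λ u≡p → u≢w (trans u≡p (sym w≡p)))
... | Tp≢Tq , Tw≢Tu = _ , Tp≢Tq , ≢-sym Tw≢Tu

in≢out : ∀ {n} (S : Fin n → Bool) {u v} → S u ≡ true → S v ≡ false → u ≢ v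
in≢out S Su Sv refl with () ← trans (sym Su) Sv

2≤-of-distinct : ∀ {r} {a b : Fin r} → a ≢ b → 2 ≤ r
2≤-of-distinct {suc zero}    {zero} {zero} a≢b = ⊥-elim (a≢b refl)
2≤-of-distinct {suc (suc r)} _                 = s≤s (s≤s z≤n)

transpose[i,j]i≡j : ∀ {n} (i j : Fin n) → PC.transpose i j i ≡ j
transpose[i,j]i≡j i j rewrite dec-true (i ≟ i) refl = refl

transpose[i,j]j≡i : ∀ {n} (i j : Fin n) → PC.transpose i j j ≡ i
transpose[i,j]j≡i i j with j ≟ i
... | yes j≡i = j≡i
... | no _ rewrite dec-true (j ≟ j) refl = refl

transpose[i,j]k≡k : ∀ {n} {i j k : Fin n} → k ≢ i → k ≢ j → PC.transpose i j k ≡ k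
transpose[i,j]k≡k {i = i} {j} {k} k≢i k≢j rewrite dec-false (k ≟ i) k≢i | dec-false (k ≟ j) k≢j = refl

fresh-colour : ∀ (a b : Fin 3) → ∃ λ j → j ≢ a × j ≢ b
fresh-colour = from-yes (all? λ (a : Fin 3) → all? λ b → any? λ j → ¬? (j ≟ a) ×-dec ¬? (j ≟ b))

third-colour-unique : ∀ (a b p q : Fin 3) → a ≢ b → p ≢ a → p ≢ b → q ≢ a → q ≢ b → p ≡ q
third-colour-unique = from-yes
  (all? λ (a : Fin 3) → all? λ b → all? λ p → all? λ q →
    ¬? (a ≟ b) →-dec ¬? (p ≟ a) →-dec ¬? (p ≟ b) →-dec
    ¬? (q ≟ a) →-dec ¬? (q ≟ b) →-dec p ≟ q)

-- Graphs, and colourings determined by part of them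

module _ {n : ℕ} (G : Graph n) where

  adj? : ∀ u v → Dec (Adj G u v)
  adj? u v = adj G u v Bool.≟ true

  Adj-sym : ∀ {u v} → Adj G u v → Adj G v u
  Adj-sym {u} {v} uv = trans (Graph.sym G v u) uv

  Adj⇒≢ : ∀ {u v} → Adj G u v → u ≢ v
  Adj⇒≢ {u} uv refl with () ← trans (sym uv) (irrefl G u)

  ¬Adj⇒false : ∀ {u v} → ¬ Adj G u v → adj G u v ≡ false
  ¬Adj⇒false = ¬-not

  connected-closed : Connected G → (P : Fin n → Set) → (∀ {u w} → P u → Adj G u w → P w) →
    ∀ {x} → P x → ∀ v → P v
  connected-closed conn P closed {x} Px v = go (conn x v) Px
    where
    go : ∀ {u} → Reach G u v → P u → P v
    go here         Pu = Pu
    go (step uw wv) Pu = go wv (closed Pu uw)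

  TwoNeighbours : Fin n → Set
  TwoNeighbours v = Σ (Fin n) λ u → Σ (Fin n) λ w → u ≢ w × Adj G v u × Adj G v w

  TwoNeighboursBesides : Fin n → Fin n → Set
  TwoNeighboursBesides y v =
    Σ (Fin n) λ u → Σ (Fin n) λ w → u ≢ w × u ≢ y × w ≢ y × Adj G v u × Adj G v w

  twoNeighbours? : ∀ v → Dec (TwoNeighbours v)
  twoNeighbours? v = any? λ u → any? λ w → ¬? (u ≟ w) ×-dec adj? v u ×-dec adj? v w

  twoNeighboursBesides? : ∀ y v → Dec (TwoNeighboursBesides y v)
  twoNeighboursBesides? y v = any? λ u → any? λ w →
    ¬? (u ≟ w) ×-dec ¬? (u ≟ y) ×-dec ¬? (w ≟ y) ×-dec adj? v u ×-dec adj? v w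

  besides⇒twoNeighbours : ∀ {y v} → TwoNeighboursBesides y v → TwoNeighbours v
  besides⇒twoNeighbours (u , w , u≢w , _ , _ , vu , vw) = u , w , u≢w , vu , vw

  -- Certifies that a graph is none of K₁, K₂, a star or P₄.
  BranchingPair : Set
  BranchingPair = Σ (Fin n) λ x → Σ (Fin n) λ y → x ≢ y × TwoNeighbours y × TwoNeighboursBesides y x

  branchingPair? : Dec BranchingPair
  branchingPair? = any? λ x → any? λ y → ¬? (x ≟ y) ×-dec twoNeighbours? y ×-dec twoNeighboursBesides? y x

  twoNeighbours⇒besides : ∀ {x y} → ¬ Adj G x y → TwoNeighbours x → TwoNeighboursBesides y x
  twoNeighbours⇒besides ¬xy (u , w , u≢w , xu , xw) =
    u , w , u≢w , (λ { refl → ¬xy xu }) , (λ { refl → ¬xy xw }) , xu , xw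

  neighbours-without-besides : ∀ {x y l} → ¬ TwoNeighboursBesides y x → Adj G x l → l ≢ y →
    ∀ u → Adj G x u → u ≡ y ⊎ u ≡ l
  neighbours-without-besides {y = y} {l} ¬besides xl l≢y u xu with u ≟ y | u ≟ l
  ... | yes u≡y | _       = inj₁ u≡y
  ... | no _    | yes u≡l = inj₂ u≡l
  ... | no u≢y  | no u≢l  = ⊥-elim (¬besides (l , u , ≢-sym u≢l , l≢y , u≢y , xl , xu))

  neighbour-unique : ∀ {v u w} → ¬ TwoNeighbours v → Adj G v u → Adj G v w → u ≡ w
  neighbour-unique {v} {u} {w} ¬two vu vw = decidable-stable (u ≟ w) λ u≢w → ¬two (u , w , u≢w , vu , vw)

  star-shaped : Connected G → ∀ {x} → (∀ u → Adj G x u → ¬ TwoNeighbours u) →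
    ∀ v → v ≡ x ⊎ Adj G x v
  star-shaped conn {x} leaves = connected-closed conn (λ v → v ≡ x ⊎ Adj G x v) extend (inj₁ refl)
    where
    extend : ∀ {u w} → u ≡ x ⊎ Adj G x u → Adj G u w → w ≡ x ⊎ Adj G x w
    extend (inj₁ refl) uw = inj₂ uw
    extend (inj₂ xu)   uw = inj₁ (neighbour-unique (leaves _ xu) uw (Adj-sym xu))

  neighbour-other-than : ∀ {v} → TwoNeighbours v → ∀ z → ∃ λ m → Adj G v m × m ≢ z
  neighbour-other-than (u , w , u≢w , vu , vw) z with u ≟ z
  ... | yes refl = w , vw , ≢-sym u≢w
  ... | no u≢z   = u , vu , u≢z

  twoNeighbours⇒non-pendant : ∀ {v} → TwoNeighbours v → (degree G v ≡ᵇ 1) ≡ false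
  twoNeighbours⇒non-pendant {v} (u , w , u≢w , vu , vw) = ≥2⇒≢1 (2≤count (adj G v) u≢w vu vw)
    where
    ≥2⇒≢1 : ∀ {k} → 2 ≤ k → (k ≡ᵇ 1) ≡ false
    ≥2⇒≢1 (s≤s (s≤s _)) = refl

  Determined : (Fin n → Bool) → (Fin n → Fin 3) → Fin n → Set
  Determined S c v = ∀ c′ → Proper G c′ → Extends S c c′ → c′ v ≡ c v

  determined-in : ∀ {S c v} → S v ≡ true → Determined S c v
  determined-in {v = v} Sv c′ _ c′-ext = c′-ext v Sv

  determined-forced : ∀ {S c v a b} → Proper G c → Adj G v a → Adj G v b → c a ≢ c b →
    Determined S c a → Determined S c b → Determined S c v
  determined-forced {c = c} {v} {a} {b} pc va vb ca≢cb det-a det-b c′ pc′ c′-ext =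
    third-colour-unique (c a) (c b) (c′ v) (c v) ca≢cb
      (λ eq → pc′ v a va (trans eq (sym (det-a c′ pc′ c′-ext))))
      (λ eq → pc′ v b vb (trans eq (sym (det-b c′ pc′ c′-ext))))
      (pc v a va) (pc v b vb)

  sudoku-of-determined : ∀ {S c} → Proper G c → (∀ v → S v ≡ false → Determined S c v) →
    HasSudoku G 3 S
  sudoku-of-determined {S} {c} pc free-det =
    c , (λ u v _ _ → pc u v) , c , pc , (λ _ _ → refl) , λ c′ pc′ c′-ext v → det v c′ pc′ c′-ext
    where
    det : ∀ v → Determined S c v
    det v with S v in Sv
    ... | true  = determined-in Sv
    ... | false = free-det v Sv

  determined-of-sudoku : ∀ {S} → HasSudoku G 3 S →
    Σ (Fin n → Fin 3) λ c → Proper G c × (∀ v → Determined S c v)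
  determined-of-sudoku (_ , _ , c , pc , c-ext , unique) =
    c , pc , λ v c′ pc′ c′-ext → unique c′ pc′ (λ u Su → trans (c′-ext u Su) (c-ext u Su)) v

  proper-of-local-changes : ∀ {k} {c c′ : Fin n → Fin k} → Proper G c →
    (∀ u w → Adj G u w → c′ u ≢ c u → c′ u ≢ c′ w) → Proper G c′
  proper-of-local-changes {c = c} {c′} pc changed u w uw with c′ u ≟ c u | c′ w ≟ c w
  ... | no u-changed | _            = changed u w uw u-changed
  ... | yes _        | no w-changed = ≢-sym (changed w u (Adj-sym uw) w-changed)
  ... | yes u-same   | yes w-same   = λ eq → pc u w uw (trans (sym u-same) (trans eq w-same))

  proper-updateAt : ∀ {k} {c : Fin n → Fin k} {v j} → Proper G c → (∀ w → Adj G v w → j ≢ c w) →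
    Proper G (updateAt c v (const j))
  proper-updateAt {c = c} {v} {j} pc j-fresh = proper-of-local-changes pc changed
    where
    changed : ∀ u w → Adj G u w → updateAt c v (const j) u ≢ c u →
      updateAt c v (const j) u ≢ updateAt c v (const j) w
    changed u w uw c′u≢cu with u ≟ v
    ... | no u≢v   = ⊥-elim (c′u≢cu (updateAt-minimal u v c u≢v))
    ... | yes refl = λ eq → j-fresh w uw (begin
      j                          ≡⟨ sym (updateAt-updates u c) ⟩
      updateAt c u (const j) u   ≡⟨ eq ⟩
      updateAt c u (const j) w   ≡⟨ updateAt-minimal w u c (≢-sym (Adj⇒≢ uw)) ⟩
      c w                        ∎)
      where open ≡-Reasoning

  SeesTwoColours : (Fin n → Fin 3) → Fin n → Set
  SeesTwoColours c v = Σ (Fin n) λ u → Σ (Fin n) λ w → Adj G v u × Adj G v w × c u ≢ c w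

  seesTwoColours? : ∀ c v → Dec (SeesTwoColours c v)
  seesTwoColours? c v = any? λ u → any? λ w → adj? v u ×-dec adj? v w ×-dec ¬? (c u ≟ c w)

  monochromatic-neighbourhood : ∀ {c v} → ¬ SeesTwoColours c v →
    ∃ λ k → ∀ u → Adj G v u → c u ≡ k
  monochromatic-neighbourhood {c} {v} ¬two with any? (adj? v)
  ... | no isolated    = c v , λ u vu → ⊥-elim (isolated (u , vu))
  ... | yes (u₀ , vu₀) = c u₀ , λ u vu →
    decidable-stable (c u ≟ c u₀) λ cu≢cu₀ → ¬two (u , u₀ , vu , vu₀ , cu≢cu₀)

  -- Otherwise v could be recoloured with a colour missing from its closed neighbourhood.
  free-vertex-sees-two-colours : ∀ {S c v} → Proper G c → S v ≡ false → Determined S c v →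
    SeesTwoColours c v
  free-vertex-sees-two-colours {S} {c} {v} pc Sv det =
    decidable-stable (seesTwoColours? c v) λ ¬two → recolourable (monochromatic-neighbourhood ¬two)
    where
    recolourable : (∃ λ k → ∀ u → Adj G v u → c u ≡ k) → ⊥
    recolourable (k , mono) with fresh-colour (c v) k
    ... | j , j≢cv , j≢k = j≢cv (trans (sym (updateAt-updates v c)) (det c′ pc′ c′-ext))
      where
      c′ : Fin n → Fin 3
      c′ = updateAt c v (const j)
      pc′ : Proper G c′
      pc′ = proper-updateAt pc λ w vw j≡cw → j≢k (trans j≡cw (mono w vw))
      c′-ext : Extends S c c′
      c′-ext u Su = updateAt-minimal u v c (in≢out S Su Sv)

  sudoku-free⇒twoNeighbours : ∀ {S v} → HasSudoku G 3 S → S v ≡ false → TwoNeighbours v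
  sudoku-free⇒twoNeighbours sud Sv with determined-of-sudoku sud
  ... | c , pc , det with free-vertex-sees-two-colours pc Sv (det _)
  ...   | u , w , vu , vw , cu≢cw = u , w , (λ u≡w → cu≢cw (cong c u≡w)) , vu , vw

  sudoku-contains : ∀ {S v} → HasSudoku G 3 S → ¬ TwoNeighbours v → S v ≡ true
  sudoku-contains {S} {v} sud ¬two with S v in Sv
  ... | true  = refl
  ... | false = ⊥-elim (¬two (sudoku-free⇒twoNeighbours sud Sv))

  pendantCount≤ : ∀ {S} → HasSudoku G 3 S → pendantCount G ≤ count S
  pendantCount≤ sud = count-mono λ v pendant → sudoku-contains {v = v} sud λ two →
    case trans (sym pendant) (twoNeighbours⇒non-pendant two) of λ ()

  two-colours-among : ∀ {c v a b} → (∀ u → Adj G v u → u ≡ a ⊎ u ≡ b) →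
    SeesTwoColours c v → c a ≢ c b
  two-colours-among nbrs (u , w , vu , vw , cu≢cw) with nbrs u vu | nbrs w vw
  ... | inj₁ refl | inj₁ refl = ⊥-elim (cu≢cw refl)
  ... | inj₁ refl | inj₂ refl = cu≢cw
  ... | inj₂ refl | inj₁ refl = ≢-sym cu≢cw
  ... | inj₂ refl | inj₂ refl = ⊥-elim (cu≢cw refl)

  -- Swapping the colours of x and y would give a second extension.
  adjacent-free-pair : ∀ {S x y l m} → HasSudoku G 3 S → S x ≡ false → S y ≡ false → Adj G x y →
    (∀ u → Adj G x u → u ≡ y ⊎ u ≡ l) → (∀ u → Adj G y u → u ≡ x ⊎ u ≡ m) → ⊥
  adjacent-free-pair {S} {x} {y} {l} {m} sud Sx Sy xy nbrs-x nbrs-y with determined-of-sudoku sud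
  ... | c , pc , det = pc x y xy (sym (trans (sym c′x) (det x c′ pc′ c′-ext)))
    where
    cy≢cl : c y ≢ c l
    cy≢cl = two-colours-among nbrs-x (free-vertex-sees-two-colours pc Sx (det x))
    cx≢cm : c x ≢ c m
    cx≢cm = two-colours-among nbrs-y (free-vertex-sees-two-colours pc Sy (det y))
    c′ : Fin n → Fin 3
    c′ = c ∘ PC.transpose x y
    c′x : c′ x ≡ c y
    c′x = cong c (transpose[i,j]i≡j x y)
    c′y : c′ y ≡ c x
    c′y = cong c (transpose[i,j]j≡i x y)
    unchanged : ∀ {u} → u ≢ x → u ≢ y → c′ u ≡ c u
    unchanged u≢x u≢y = cong c (transpose[i,j]k≡k u≢x u≢y)
    swapped : ∀ {u} → c′ u ≢ c u → u ≡ x ⊎ u ≡ y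
    swapped {u} c′u≢cu = endpoint (u ≟ x) (u ≟ y)
      where
      endpoint : Dec (u ≡ x) → Dec (u ≡ y) → u ≡ x ⊎ u ≡ y
      endpoint (yes u≡x) _         = inj₁ u≡x
      endpoint (no _)    (yes u≡y) = inj₂ u≡y
      endpoint (no u≢x)  (no u≢y)  = ⊥-elim (c′u≢cu (unchanged u≢x u≢y))
    changed : ∀ u w → Adj G u w → c′ u ≢ c u → c′ u ≢ c′ w
    changed u w uw c′u≢cu with swapped c′u≢cu
    ... | inj₁ refl with nbrs-x w uw
    ...   | inj₁ refl = λ eq → pc x y xy (trans (sym c′y) (trans (sym eq) c′x))
    ...   | inj₂ refl = λ eq → cy≢cl (trans (sym c′x) (trans eq
                          (unchanged (≢-sym (Adj⇒≢ uw)) λ { refl → cy≢cl refl })))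
    changed u w uw c′u≢cu | inj₂ refl with nbrs-y w uw
    ...   | inj₁ refl = λ eq → pc x y xy (trans (sym c′y) (trans eq c′x))
    ...   | inj₂ refl = λ eq → cx≢cm (trans (sym c′y) (trans eq
                          (unchanged (λ { refl → cx≢cm refl }) (≢-sym (Adj⇒≢ uw)))))
    pc′ : Proper G c′
    pc′ = proper-of-local-changes pc changed
    c′-ext : Extends S c c′
    c′-ext u Su = unchanged (in≢out S Su Sx) (in≢out S Su Sy)

-- Sudoku sets of bipartite graphs

module Bipartite {n : ℕ} (G : Graph n) (side : Fin n → Bool)
                 (bip : ∀ u v → Adj G u v → side u ≢ side v) where

  offColour : Bool → Fin 3
  offColour true  = suc zero
  offColour false = suc (suc zero)

  offColour≢zero : ∀ b → offColour b ≢ zero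
  offColour≢zero true  ()
  offColour≢zero false ()

  offColour-injective : ∀ {a b} → a ≢ b → offColour a ≢ offColour b
  offColour-injective {true}  {true}  a≢b = ⊥-elim (a≢b refl)
  offColour-injective {true}  {false} _   = λ ()
  offColour-injective {false} {true}  _   = λ ()
  offColour-injective {false} {false} a≢b = ⊥-elim (a≢b refl)

  module _ (s : Bool) (T : Fin n → Bool) where

    sideColouring : Fin n → Fin 3
    sideColouring v = if does (side v Bool.≟ s) then zero else offColour (T v)

    sideColouring-on : ∀ {v} → side v ≡ s → sideColouring v ≡ zero
    sideColouring-on {v} on rewrite dec-true (side v Bool.≟ s) on = refl

    sideColouring-off : ∀ {v} → side v ≢ s → sideColouring v ≡ offColour (T v)
    sideColouring-off {v} off rewrite dec-false (side v Bool.≟ s) off = refl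

    sideColouring-proper : Proper G sideColouring
    sideColouring-proper u w uw = sides (side u Bool.≟ s) (side w Bool.≟ s)
      where
      sides : Dec (side u ≡ s) → Dec (side w ≡ s) → sideColouring u ≢ sideColouring w
      sides (yes u-on) (yes w-on) = ⊥-elim (bip u w uw (trans u-on (sym w-on)))
      sides (yes u-on) (no w-off) eq = offColour≢zero (T w)
        (trans (sym (sideColouring-off w-off)) (trans (sym eq) (sideColouring-on u-on)))
      sides (no u-off) (yes w-on) eq = offColour≢zero (T u)
        (trans (sym (sideColouring-off u-off)) (trans eq (sideColouring-on w-on)))
      sides (no u-off) (no w-off) = ⊥-elim (bip u w uw (trans (¬-not u-off) (sym (¬-not w-off))))

    sideColouring-separates : ∀ {a b} → side a ≢ s → side b ≢ s → T a ≢ T b →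
      sideColouring a ≢ sideColouring b
    sideColouring-separates a-off b-off Ta≢Tb eq = offColour-injective Ta≢Tb
      (trans (sym (sideColouring-off a-off)) (trans eq (sideColouring-off b-off)))

  opposite-sides : ∀ {u v} → Adj G u v → side v ≢ side u
  opposite-sides {u} {v} uv = ≢-sym (bip u v uv)

  sudoku-allBut : ∀ {x} → TwoNeighbours G x → HasSudoku G 3 (allBut x)
  sudoku-allBut {x} (u , w , u≢w , xu , xw) = sudoku-of-determined G pc free-det
    where
    c : Fin n → Fin 3
    c = sideColouring (side x) (_== u)
    pc : Proper G c
    pc = sideColouring-proper (side x) (_== u)
    cu≢cw : c u ≢ c w
    cu≢cw = sideColouring-separates (side x) (_== u) (opposite-sides xu) (opposite-sides xw)
      (==-separates u≢w)
    free-det : ∀ v → allBut x v ≡ false → Determined G (allBut x) c v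
    free-det v v∉ with allBut-∌ x v v∉
    ... | refl = determined-forced G pc xu xw cu≢cw
      (determined-in G (allBut-∋ (≢-sym (Adj⇒≢ G xu))))
      (determined-in G (allBut-∋ (≢-sym (Adj⇒≢ G xw))))

  sudoku-allBut₂-sameSide : ∀ {x y} → side x ≡ side y → TwoNeighbours G x → TwoNeighbours G y →
    HasSudoku G 3 (allBut₂ x y)
  sudoku-allBut₂-sameSide {x} {y} same (p , q , p≢q , xp , xq) (u , w , u≢w , yu , yw)
    with separating p≢q u≢w
  ... | T , Tp≢Tq , Tu≢Tw = sudoku-of-determined G pc free-det
    where
    c : Fin n → Fin 3
    c = sideColouring (side x) T
    pc : Proper G c
    pc = sideColouring-proper (side x) T
    off-side : ∀ {v a} → side v ≡ side x → Adj G v a → side a ≢ side x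
    off-side v-on va = subst (side _ ≢_) v-on (opposite-sides va)
    in-S : ∀ {v a} → side v ≡ side x → Adj G v a → allBut₂ x y a ≡ true
    in-S {a = a} v-on va = allBut₂-∋ {v = a} (λ { refl → off-side v-on va refl })
                                     (λ { refl → off-side v-on va (sym same) })
    forced-by : ∀ {v a b} → side v ≡ side x → Adj G v a → Adj G v b → T a ≢ T b →
      Determined G (allBut₂ x y) c v
    forced-by v-on va vb Ta≢Tb = determined-forced G pc va vb
      (sideColouring-separates (side x) T (off-side v-on va) (off-side v-on vb) Ta≢Tb)
      (determined-in G (in-S v-on va)) (determined-in G (in-S v-on vb))
    free-det : ∀ v → allBut₂ x y v ≡ false → Determined G (allBut₂ x y) c v
    free-det v v∉ with allBut₂-∌ x y v v∉
    ... | inj₁ refl = forced-by refl xp xq Tp≢Tq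
    ... | inj₂ refl = forced-by (sym same) yu yw Tu≢Tw

  -- y's side gets colour 0, x colour 1 and the rest of x's side colour 2; then the leaf l₁ is
  -- moved to colour 2, so that l₁, l₂ force x, after which x and m force y.
  sudoku-allBut₂-edge : ∀ {x y l₁ l₂ m} → Adj G x y → Adj G x l₁ → Adj G x l₂ → l₁ ≢ l₂ →
    l₁ ≢ y → l₂ ≢ y → ¬ TwoNeighbours G l₁ → Adj G y m → m ≢ x → HasSudoku G 3 (allBut₂ x y)
  sudoku-allBut₂-edge {x} {y} {l₁} {l₂} {m} xy xl₁ xl₂ l₁≢l₂ l₁≢y l₂≢y leaf ym m≢x =
    sudoku-of-determined G pc free-det
    where
    c₀ c : Fin n → Fin 3
    c₀ = sideColouring (side y) (_== x)
    c  = updateAt c₀ l₁ (const (offColour false))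
    only-x : ∀ {w} → Adj G l₁ w → w ≡ x
    only-x l₁w = neighbour-unique G leaf l₁w (Adj-sym G xl₁)
    unchanged : ∀ {v} → v ≢ l₁ → c v ≡ c₀ v
    unchanged {v} v≢l₁ = updateAt-minimal v l₁ c₀ v≢l₁
    c₀x : c₀ x ≡ offColour true
    c₀x = trans (sideColouring-off (side y) (_== x) (bip x y xy)) (cong offColour (==-refl x))
    c₀m : c₀ m ≡ offColour false
    c₀m = trans (sideColouring-off (side y) (_== x) (opposite-sides ym)) (cong offColour (==-≢ m≢x))
    c₀l₂ : c₀ l₂ ≡ zero
    c₀l₂ = sideColouring-on (side y) (_== x)
      (trans (¬-not (opposite-sides xl₂)) (sym (¬-not (opposite-sides xy))))
    pc : Proper G c
    pc = proper-updateAt G (sideColouring-proper (side y) (_== x)) λ w l₁w eq →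
      offColour-injective {false} {true} (λ ()) (trans eq (trans (cong c₀ (only-x l₁w)) c₀x))
    cl₁≢cl₂ : c l₁ ≢ c l₂
    cl₁≢cl₂ eq = offColour≢zero false
      (trans (sym (updateAt-updates l₁ c₀)) (trans eq (trans (unchanged (≢-sym l₁≢l₂)) c₀l₂)))
    cx≢cm : c x ≢ c m
    cx≢cm eq = offColour-injective {true} {false} (λ ())
      (trans (sym c₀x) (trans (sym (unchanged (Adj⇒≢ G xl₁))) (trans eq (trans (unchanged m≢l₁) c₀m))))
      where
      m≢l₁ : m ≢ l₁
      m≢l₁ refl = Adj⇒≢ G xy (sym (only-x (Adj-sym G ym)))
    det-x : Determined G (allBut₂ x y) c x
    det-x = determined-forced G pc xl₁ xl₂ cl₁≢cl₂
      (determined-in G (allBut₂-∋ (≢-sym (Adj⇒≢ G xl₁)) l₁≢y))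
      (determined-in G (allBut₂-∋ (≢-sym (Adj⇒≢ G xl₂)) l₂≢y))
    det-y : Determined G (allBut₂ x y) c y
    det-y = determined-forced G pc (Adj-sym G xy) ym cx≢cm det-x
      (determined-in G (allBut₂-∋ m≢x (≢-sym (Adj⇒≢ G ym))))
    free-det : ∀ v → allBut₂ x y v ≡ false → Determined G (allBut₂ x y) c v
    free-det v v∉ with allBut₂-∌ x y v v∉
    ... | inj₁ refl = det-x
    ... | inj₂ refl = det-y

-- Isomorphisms and the small graphs

module _ {n m : ℕ} (G : Graph n) (H : Graph m) (iso : Iso G H) where
  open Inverse (proj₁ iso)

  iso-injective : ∀ {u v} → to u ≡ to v → u ≡ v
  iso-injective {u} {v} eq = trans (sym (strictlyInverseʳ u)) (trans (cong from eq) (strictlyInverseʳ v))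

  iso-Adj : ∀ {u v} → Adj G u v → Adj H (to u) (to v)
  iso-Adj {u} {v} uv = trans (proj₂ iso u v) uv

  iso-TwoNeighbours : ∀ {v} → TwoNeighbours G v → TwoNeighbours H (to v)
  iso-TwoNeighbours (u , w , u≢w , vu , vw) =
    to u , to w , u≢w ∘ iso-injective , iso-Adj vu , iso-Adj vw

  iso-TwoNeighboursBesides : ∀ {y v} → TwoNeighboursBesides G y v → TwoNeighboursBesides H (to y) (to v)
  iso-TwoNeighboursBesides (u , w , u≢w , u≢y , w≢y , vu , vw) =
    to u , to w , u≢w ∘ iso-injective , u≢y ∘ iso-injective , w≢y ∘ iso-injective , iso-Adj vu , iso-Adj vw

  iso-BranchingPair : BranchingPair G → BranchingPair H
  iso-BranchingPair (x , y , x≢y , two-y , besides) =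
    to x , to y , x≢y ∘ iso-injective , iso-TwoNeighbours two-y , iso-TwoNeighboursBesides besides

  iso-sym : Iso H G
  iso-sym = mk↔ₛ′ from to strictlyInverseʳ strictlyInverseˡ , λ a b →
    trans (sym (proj₂ iso (from a) (from b))) (cong₂ (adj H) (strictlyInverseˡ a) (strictlyInverseˡ b))

iso-of-enumeration : ∀ {n m} (G : Graph n) (H : Graph m) (vs : Vec (Fin n) m) → Unique vs →
  (∀ v → v ∈ vs) → (∀ i j → adj H i j ≡ adj G (lookup vs i) (lookup vs j)) → Iso G H
iso-of-enumeration {n} {m} G H vs unique cover adj-vs =
  mk↔ₛ′ index (lookup vs) index∘lookup lookup∘index , adj-index
  where
  index : Fin n → Fin m
  index v = Any.index (cover v)
  lookup∘index : ∀ v → lookup vs (index v) ≡ v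
  lookup∘index v = sym (lookup-index (cover v))
  index∘lookup : ∀ i → index (lookup vs i) ≡ i
  index∘lookup i = lookup-injective unique _ _ (lookup∘index (lookup vs i))
  adj-index : ∀ u v → adj H (index u) (index v) ≡ adj G u v
  adj-index u v = trans (adj-vs (index u) (index v)) (cong₂ (adj G) (lookup∘index u) (lookup∘index v))

starAdj-centreˡ : ∀ {r} {j : Fin (suc r)} → j ≢ zero → starAdj zero j ≡ true
starAdj-centreˡ {j = zero}  j≢0 = ⊥-elim (j≢0 refl)
starAdj-centreˡ {j = suc _} _   = refl

starAdj-centreʳ : ∀ {r} {i : Fin (suc r)} → i ≢ zero → starAdj i zero ≡ true
starAdj-centreʳ {i = zero}  i≢0 = ⊥-elim (i≢0 refl)
starAdj-centreʳ {i = suc _} _   = refl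

starAdj-leaves : ∀ {r} {i j : Fin (suc r)} → i ≢ zero → j ≢ zero → starAdj i j ≡ false
starAdj-leaves {i = zero}              i≢0 _   = ⊥-elim (i≢0 refl)
starAdj-leaves {i = suc _} {j = zero}  _   j≢0 = ⊥-elim (j≢0 refl)
starAdj-leaves {i = suc _} {j = suc _} _   _   = refl

star-iso : ∀ {r} (G : Graph (suc r)) → Connected G → ∀ x → (∀ v → v ≢ x → ¬ TwoNeighbours G v) →
  Iso G (star r)
star-iso {r} G conn x leaf = transpose x zero , adj-τ
  where
  τ : Fin (suc r) → Fin (suc r)
  τ = PC.transpose x zero
  τ-centre : τ x ≡ zero
  τ-centre = transpose[i,j]i≡j x zero
  τ-leaf : ∀ {v} → v ≢ x → τ v ≢ zero
  τ-leaf {v} v≢x τv≡0 = v≢x (begin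
    v                          ≡⟨ sym (transpose-inverse zero x) ⟩
    PC.transpose zero x (τ v)  ≡⟨ cong (PC.transpose zero x) τv≡0 ⟩
    PC.transpose zero x zero   ≡⟨ transpose[i,j]i≡j zero x ⟩
    x                          ∎)
    where open ≡-Reasoning
  centre-adj : ∀ {v} → v ≢ x → Adj G x v
  centre-adj {v} v≢x with star-shaped G conn (λ u xu → leaf u (≢-sym (Adj⇒≢ G xu))) v
  ... | inj₁ v≡x = ⊥-elim (v≢x v≡x)
  ... | inj₂ xv  = xv
  leaves-apart : ∀ {u w} → u ≢ x → w ≢ x → adj G u w ≡ false
  leaves-apart u≢x w≢x =
    ¬Adj⇒false G λ uw → w≢x (neighbour-unique G (leaf _ u≢x) uw (Adj-sym G (centre-adj u≢x)))
  -- A `with u ≟ x` would also abstract the very same test inside τ u, so split on passed decisions.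
  cases : ∀ u v → Dec (u ≡ x) → Dec (v ≡ x) → starAdj (τ u) (τ v) ≡ adj G u v
  cases _ _ (yes refl) (yes refl) =
    trans (cong₂ starAdj τ-centre τ-centre) (sym (irrefl G x))
  cases _ v (yes refl) (no v≢x) =
    trans (cong (λ i → starAdj i (τ v)) τ-centre)
          (trans (starAdj-centreˡ (τ-leaf v≢x)) (sym (centre-adj v≢x)))
  cases u _ (no u≢x) (yes refl) =
    trans (cong (starAdj (τ u)) τ-centre)
          (trans (starAdj-centreʳ (τ-leaf u≢x)) (sym (Adj-sym G (centre-adj u≢x))))
  cases u v (no u≢x) (no v≢x) =
    trans (starAdj-leaves (τ-leaf u≢x) (τ-leaf v≢x)) (sym (leaves-apart u≢x v≢x))
  adj-τ : ∀ u v → starAdj (τ u) (τ v) ≡ adj G u v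
  adj-τ u v = cases u v (u ≟ x) (v ≟ x)

star-twoNeighbours : ∀ {r v} → TwoNeighbours (star r) v → v ≡ zero × 2 ≤ r
star-twoNeighbours {v = zero} (suc a , suc b , a≢b , _ , _) = refl , 2≤-of-distinct (a≢b ∘ cong suc)
star-twoNeighbours {v = suc _} (zero , zero , u≢w , _ , _) = ⊥-elim (u≢w refl)
star-twoNeighbours {v = suc _} (zero , suc _ , _ , _ , ())
star-twoNeighbours {v = suc _} (suc _ , _ , _ , () , _)

star-centre-twoNeighbours : ∀ {r} → 2 ≤ r → TwoNeighbours (star r) zero
star-centre-twoNeighbours (s≤s (s≤s _)) = suc zero , suc (suc zero) , (λ ()) , refl , refl

star-noBranchingPair : ∀ {r} → ¬ BranchingPair (star r)
star-noBranchingPair (x , y , x≢y , two-y , besides) =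
  x≢y (trans (proj₁ (star-twoNeighbours (besides⇒twoNeighbours (star _) besides)))
             (sym (proj₁ (star-twoNeighbours two-y))))

P4-twoNeighbours : TwoNeighbours P4 (suc zero)
P4-twoNeighbours = zero , suc (suc zero) , (λ ()) , refl , refl

P4-noBranchingPair : ¬ BranchingPair P4
P4-noBranchingPair = from-yes (¬? (branchingPair? P4))

record ClosedPath₄ {n} (G : Graph n) (l x y m : Fin n) : Set where
  field
    xl     : Adj G x l
    xy     : Adj G x y
    ym     : Adj G y m
    l≢y    : l ≢ y
    m≢x    : m ≢ x
    nbrs-l : ∀ u → Adj G l u → u ≡ x
    nbrs-x : ∀ u → Adj G x u → u ≡ y ⊎ u ≡ l
    nbrs-y : ∀ u → Adj G y u → u ≡ x ⊎ u ≡ m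
    nbrs-m : ∀ u → Adj G m u → u ≡ y

module _ {n} (G : Graph n) {l x y m : Fin n} (closed : ClosedPath₄ G l x y m) where
  open ClosedPath₄ closed

  path₄ : Vec (Fin n) 4
  path₄ = l ∷ x ∷ y ∷ m ∷ []

  closedPath₄-cover : Connected G → ∀ v → v ∈ path₄
  closedPath₄-cover conn = connected-closed G conn (_∈ path₄) extend (there (here refl))
    where
    extend : ∀ {u w} → u ∈ path₄ → Adj G u w → w ∈ path₄
    extend (here refl) lw = there (here (nbrs-l _ lw))
    extend (there (here refl)) xw with nbrs-x _ xw
    ... | inj₁ refl = there (there (here refl))
    ... | inj₂ refl = here refl
    extend (there (there (here refl))) yw with nbrs-y _ yw
    ... | inj₁ refl = there (here refl)
    ... | inj₂ refl = there (there (there (here refl)))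
    extend (there (there (there (here refl)))) mw = there (there (here (nbrs-m _ mw)))

  closedPath₄-iso : Connected G → Iso G P4
  closedPath₄-iso conn = iso-of-enumeration G P4 (path₄) unique (closedPath₄-cover conn) adj-table
    where
    x≢y : x ≢ y
    x≢y = Adj⇒≢ G xy
    ¬ly : ¬ Adj G l y
    ¬ly ly = x≢y (sym (nbrs-l _ ly))
    ¬lm : ¬ Adj G l m
    ¬lm lm = m≢x (nbrs-l _ lm)
    l≢m : l ≢ m
    l≢m refl = ¬ly (Adj-sym G ym)
    ¬xm : ¬ Adj G x m
    ¬xm xm = [ Adj⇒≢ G ym ∘ sym , l≢m ∘ sym ]′ (nbrs-x _ xm)
    unique : Unique (path₄)
    unique = (≢-sym (Adj⇒≢ G xl) ∷ l≢y ∷ l≢m ∷ []) ∷ (x≢y ∷ ≢-sym m≢x ∷ []) ∷ (Adj⇒≢ G ym ∷ []) ∷ [] ∷ []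
    adj-table : ∀ i j → adj P4 i j ≡ adj G (lookup (path₄) i) (lookup (path₄) j)
    adj-table zero                   zero                   = sym (irrefl G l)
    adj-table zero                   (suc zero)             = sym (Adj-sym G xl)
    adj-table zero                   (suc (suc zero))       = sym (¬Adj⇒false G ¬ly)
    adj-table zero                   (suc (suc (suc zero))) = sym (¬Adj⇒false G ¬lm)
    adj-table (suc zero)             zero                   = sym xl
    adj-table (suc zero)             (suc zero)             = sym (irrefl G x)
    adj-table (suc zero)             (suc (suc zero))       = sym xy
    adj-table (suc zero)             (suc (suc (suc zero))) = sym (¬Adj⇒false G ¬xm)
    adj-table (suc (suc zero))       zero                   = sym (¬Adj⇒false G (¬ly ∘ Adj-sym G))
    adj-table (suc (suc zero))       (suc zero)             = sym (Adj-sym G xy)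
    adj-table (suc (suc zero))       (suc (suc zero))       = sym (irrefl G y)
    adj-table (suc (suc zero))       (suc (suc (suc zero))) = sym ym
    adj-table (suc (suc (suc zero))) zero                   = sym (¬Adj⇒false G (¬lm ∘ Adj-sym G))
    adj-table (suc (suc (suc zero))) (suc zero)             = sym (¬Adj⇒false G (¬xm ∘ Adj-sym G))
    adj-table (suc (suc (suc zero))) (suc (suc zero))       = sym (Adj-sym G ym)
    adj-table (suc (suc (suc zero))) (suc (suc (suc zero))) = sym (irrefl G m)

SmallComplete : ∀ {n} → Graph n → Set
SmallComplete G = Iso G (complete 1) ⊎ Iso G (complete 2)

StarOrP4 : ∀ {n} → Graph n → Set
StarOrP4 G = (Σ ℕ λ r → r ≥ 2 × Iso G (star r)) ⊎ Iso G P4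

smallComplete-noTwoNeighbours : ∀ {n} (G : Graph n) → SmallComplete G → ∀ v → ¬ TwoNeighbours G v
smallComplete-noTwoNeighbours G (inj₁ iso) v two = from-yes (¬? (any? (twoNeighbours? (complete 1))))
  (Inverse.to (proj₁ iso) v , iso-TwoNeighbours G (complete 1) iso two)
smallComplete-noTwoNeighbours G (inj₂ iso) v two = from-yes (¬? (any? (twoNeighbours? (complete 2))))
  (Inverse.to (proj₁ iso) v , iso-TwoNeighbours G (complete 2) iso two)

starOrP4-twoNeighbours : ∀ {n} (G : Graph n) → StarOrP4 G → ∃ (TwoNeighbours G)
starOrP4-twoNeighbours G (inj₁ (r , 2≤r , iso)) =
  _ , iso-TwoNeighbours (star r) G (iso-sym G (star r) iso) (star-centre-twoNeighbours 2≤r)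
starOrP4-twoNeighbours G (inj₂ iso) =
  _ , iso-TwoNeighbours P4 G (iso-sym G P4 iso) P4-twoNeighbours

smallComplete⇒¬starOrP4 : ∀ {n} (G : Graph n) → SmallComplete G → ¬ StarOrP4 G
smallComplete⇒¬starOrP4 G K SP =
  let v , two = starOrP4-twoNeighbours G SP in smallComplete-noTwoNeighbours G K v two

starOrP4-noBranchingPair : ∀ {n} (G : Graph n) → StarOrP4 G → ¬ BranchingPair G
starOrP4-noBranchingPair G (inj₁ (r , _ , iso)) = star-noBranchingPair ∘ iso-BranchingPair G (star r) iso
starOrP4-noBranchingPair G (inj₂ iso)           = P4-noBranchingPair ∘ iso-BranchingPair G P4 iso

-- Classification

data Outcome {n} (G : Graph n) (s : ℕ) : Set where
  complete-like : s ≡ n     → SmallComplete G → Outcome G s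
  star-like     : s ≡ n ∸ 1 → StarOrP4 G      → Outcome G s
  sparse        : s ≤ n ∸ 2 → BranchingPair G → Outcome G s

sparse-bounds : ∀ {n s} → 2 ≤ n → s ≤ n ∸ 2 → s ≢ n × s ≢ n ∸ 1
sparse-bounds (s≤s (s≤s _)) s≤ =
  (λ { refl → 1+n≰n (≤-trans (n≤1+n _) s≤) }) , (λ { refl → 1+n≰n s≤ })

outcome-characterises : ∀ {n} {G : Graph n} {s} → 1 ≤ n → Outcome G s →
  (s ≡ n ⇔ SmallComplete G) × (s ≡ n ∸ 1 ⇔ StarOrP4 G)
outcome-characterises {G = G} (s≤s z≤n) (complete-like s≡n K) =
  mk⇔ (λ _ → K) (λ _ → s≡n) ,
  mk⇔ (λ s≡n∸1 → ⊥-elim (1+n≢n (trans (sym s≡n) s≡n∸1)))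
      (⊥-elim ∘ smallComplete⇒¬starOrP4 G K)
outcome-characterises {G = G} (s≤s z≤n) (star-like s≡n∸1 SP) =
  mk⇔ (λ s≡n → ⊥-elim (1+n≢n (trans (sym s≡n) s≡n∸1)))
      (λ K → ⊥-elim (smallComplete⇒¬starOrP4 G K SP)) ,
  mk⇔ (λ _ → SP) (λ _ → s≡n∸1)
outcome-characterises {n} {G} {s} _ (sparse s≤ pair@(x , y , x≢y , two-y , _)) =
  mk⇔ (⊥-elim ∘ proj₁ bounds) (λ K → ⊥-elim (smallComplete-noTwoNeighbours G K y two-y)) ,
  mk⇔ (⊥-elim ∘ proj₂ bounds) (λ SP → ⊥-elim (starOrP4-noBranchingPair G SP pair))
  where
  bounds : s ≢ n × s ≢ n ∸ 1
  bounds = sparse-bounds (2≤-of-distinct x≢y) s≤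

module Classification {r : ℕ} (G : Graph (suc r)) (conn : Connected G)
                      (side : Fin (suc r) → Bool) (bip : ∀ u v → Adj G u v → side u ≢ side v)
                      {s : ℕ} (sn : IsSudokuNumber G 3 s) where

  open Bipartite G side bip

  sn≤ : ∀ {S} → HasSudoku G 3 S → s ≤ count S
  sn≤ {S} = proj₂ sn S

  ≤sn : ∀ {t} → (∀ {S} → HasSudoku G 3 S → t ≤ count S) → t ≤ s
  ≤sn {t} lower with proj₁ sn
  ... | S₀ , |S₀|≡s , sud₀ = subst (t ≤_) |S₀|≡s (lower sud₀)

  s≤n : s ≤ suc r
  s≤n with proj₁ sn
  ... | S₀ , |S₀|≡s , _ = subst (_≤ suc r) |S₀|≡s (count≤n S₀)

  pendantCount≤s : pendantCount G ≤ s
  pendantCount≤s = ≤sn (pendantCount≤ G)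

  s≤n∸1 : ∀ {x} → TwoNeighbours G x → s ≤ r
  s≤n∸1 {x} two = subst (s ≤_) (count-allBut x) (sn≤ (sudoku-allBut two))

  s≤n∸2 : ∀ {x y} → x ≢ y → HasSudoku G 3 (allBut₂ x y) → s ≤ suc r ∸ 2
  s≤n∸2 x≢y sud = subst (s ≤_) (count-allBut₂ x≢y) (sn≤ sud)

  n∸1≤ : ∀ {S : Fin (suc r) → Bool} z → (∀ v → S v ≡ false → v ≡ z) → r ≤ count S
  n∸1≤ {S} z free≡z = subst (_≤ count S) (cong (suc r ∸_) (count-== z))
    (count-cover S (_== z) λ v Sv → dec-true (v ≟ z) (free≡z v Sv))

  no-branching : (∀ v → ¬ TwoNeighbours G v) → Outcome G s
  no-branching none = complete-like (≤-antisym s≤n (≤sn n≤)) small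
    where
    n≤ : ∀ {S} → HasSudoku G 3 S → suc r ≤ count S
    n≤ {S} sud = subst (_≤ count S) (cong (suc r ∸_) (count-false {suc r}))
      (count-cover S (const false) λ v Sv → ⊥-elim (none v (sudoku-free⇒twoNeighbours G sud Sv)))
    small : SmallComplete G
    small with any? (adj? G zero)
    ... | no isolated = inj₁ (iso-of-enumeration G (complete 1) (zero ∷ []) ([] ∷ []) cover adj-table)
      where
      cover : ∀ v → v ∈ zero ∷ []
      cover = connected-closed G conn (_∈ zero ∷ [])
        (λ { (here refl) 0w → ⊥-elim (isolated (_ , 0w)) }) (here refl)
      adj-table : ∀ i j → adj (complete 1) i j ≡ adj G (lookup (zero ∷ []) i) (lookup (zero ∷ []) j)
      adj-table zero zero = sym (irrefl G zero)
    ... | yes (v , 0v) =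
      inj₂ (iso-of-enumeration G (complete 2) (zero ∷ v ∷ []) ((Adj⇒≢ G 0v ∷ []) ∷ [] ∷ []) cover adj-table)
      where
      extend : ∀ {u w} → u ∈ zero ∷ v ∷ [] → Adj G u w → w ∈ zero ∷ v ∷ []
      extend (here refl)         0w = there (here (neighbour-unique G (none zero) 0w 0v))
      extend (there (here refl)) vw = here (neighbour-unique G (none v) vw (Adj-sym G 0v))
      cover : ∀ w → w ∈ zero ∷ v ∷ []
      cover = connected-closed G conn (_∈ zero ∷ v ∷ []) extend (here refl)
      adj-table : ∀ i j →
        adj (complete 2) i j ≡ adj G (lookup (zero ∷ v ∷ []) i) (lookup (zero ∷ v ∷ []) j)
      adj-table zero       zero       = sym (irrefl G zero)
      adj-table zero       (suc zero) = sym 0v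
      adj-table (suc zero) zero       = sym (Adj-sym G 0v)
      adj-table (suc zero) (suc zero) = sym (irrefl G v)

  one-branching : ∀ {x} → TwoNeighbours G x → (∀ v → v ≢ x → ¬ TwoNeighbours G v) → Outcome G s
  one-branching {x} two-x leaf =
    star-like (≤-antisym (s≤n∸1 two-x) (≤sn λ {S} sud → n∸1≤ {S} x (free≡x sud)))
              (inj₁ (r , 2≤r , iso))
    where
    iso : Iso G (star r)
    iso = star-iso G conn x leaf
    2≤r : 2 ≤ r
    2≤r = proj₂ (star-twoNeighbours (iso-TwoNeighbours G (star r) iso two-x))
    free≡x : ∀ {S} → HasSudoku G 3 S → ∀ v → S v ≡ false → v ≡ x
    free≡x sud v Sv = decidable-stable (v ≟ x) λ v≢x → leaf v v≢x (sudoku-free⇒twoNeighbours G sud Sv)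

  same-side : ∀ {x y} → x ≢ y → side x ≡ side y → TwoNeighbours G x → TwoNeighbours G y → Outcome G s
  same-side {x} {y} x≢y same two-x two-y =
    sparse (s≤n∸2 x≢y (sudoku-allBut₂-sameSide same two-x two-y))
           (x , y , x≢y , two-y , twoNeighbours⇒besides G (λ xy → bip x y xy same) two-x)

  OnlyBranching : Fin (suc r) → Fin (suc r) → Set
  OnlyBranching x y = ∀ z → z ≢ x → z ≢ y → ¬ TwoNeighbours G z

  edge-with-branch : ∀ {x y} → x ≢ y → Adj G x y → TwoNeighbours G y → TwoNeighboursBesides G y x →
    OnlyBranching x y → Outcome G s
  edge-with-branch {x} {y} x≢y xy two-y besides@(l₁ , l₂ , l₁≢l₂ , l₁≢y , l₂≢y , xl₁ , xl₂) others
    with neighbour-other-than G two-y x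
  ... | m , ym , m≢x = sparse
    (s≤n∸2 x≢y (sudoku-allBut₂-edge xy xl₁ xl₂ l₁≢l₂ l₁≢y l₂≢y leaf ym m≢x))
    (x , y , x≢y , two-y , besides)
    where
    leaf : ¬ TwoNeighbours G l₁
    leaf = others l₁ (≢-sym (Adj⇒≢ G xl₁)) l₁≢y

  path : ∀ {x y} → Adj G x y → TwoNeighbours G x → TwoNeighbours G y →
    ¬ TwoNeighboursBesides G y x → ¬ TwoNeighboursBesides G x y → OnlyBranching x y → Outcome G s
  path {x} {y} xy two-x two-y ¬besides-x ¬besides-y others
    with neighbour-other-than G two-x y | neighbour-other-than G two-y x
  ... | l , xl , l≢y | m , ym , m≢x =
    star-like (≤-antisym (s≤n∸1 two-x) (≤sn one-free)) (inj₂ (closedPath₄-iso G closed conn))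
    where
    closed : ClosedPath₄ G l x y m
    closed = record
      { xl = xl ; xy = xy ; ym = ym ; l≢y = l≢y ; m≢x = m≢x
      ; nbrs-l = λ u lu → neighbour-unique G (others _ (≢-sym (Adj⇒≢ G xl)) l≢y) lu (Adj-sym G xl)
      ; nbrs-x = neighbours-without-besides G ¬besides-x xl l≢y
      ; nbrs-y = neighbours-without-besides G ¬besides-y ym m≢x
      ; nbrs-m = λ u mu → neighbour-unique G (others _ m≢x (≢-sym (Adj⇒≢ G ym))) mu (Adj-sym G ym)
      }
    open ClosedPath₄ closed using (nbrs-x; nbrs-y)
    free-x-or-y : ∀ {S} → HasSudoku G 3 S → ∀ v → S v ≡ false → v ≡ x ⊎ v ≡ y
    free-x-or-y sud v Sv with v ≟ x | v ≟ y
    ... | yes v≡x | _       = inj₁ v≡x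
    ... | no _    | yes v≡y = inj₂ v≡y
    ... | no v≢x  | no v≢y  = ⊥-elim (others v v≢x v≢y (sudoku-free⇒twoNeighbours G sud Sv))
    one-free : ∀ {S} → HasSudoku G 3 S → r ≤ count S
    one-free {S} sud with S x in Sx | S y in Sy
    ... | false | false = ⊥-elim (adjacent-free-pair G sud Sx Sy xy nbrs-x nbrs-y)
    ... | true  | _     = n∸1≤ y λ v Sv →
      [ (λ { refl → ⊥-elim (in≢out S Sx Sv refl) }) , id ]′ (free-x-or-y sud v Sv)
    ... | false | true  = n∸1≤ x λ v Sv →
      [ id , (λ { refl → ⊥-elim (in≢out S Sy Sv refl) }) ]′ (free-x-or-y sud v Sv)

  exactly-two : ∀ {x y} → x ≢ y → TwoNeighbours G x → TwoNeighbours G y → OnlyBranching x y → Outcome G s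
  exactly-two {x} {y} x≢y two-x two-y others with adj? G x y
  ... | no ¬xy = ⊥-elim ([ ≢-sym x≢y , ¬xy ]′ (star-shaped G conn leaves y))
    where
    leaves : ∀ u → Adj G x u → ¬ TwoNeighbours G u
    leaves u xu = others u (≢-sym (Adj⇒≢ G xu)) λ { refl → ¬xy xu }
  ... | yes xy with twoNeighboursBesides? G y x | twoNeighboursBesides? G x y
  ...   | yes besides | _           = edge-with-branch x≢y xy two-y besides others
  ...   | no _        | yes besides =
    edge-with-branch (≢-sym x≢y) (Adj-sym G xy) two-x besides λ z z≢y z≢x → others z z≢x z≢y
  ...   | no ¬besides-x | no ¬besides-y = path xy two-x two-y ¬besides-x ¬besides-y others

  several-branching : ∀ {x y} → x ≢ y → TwoNeighbours G x → TwoNeighbours G y → Outcome G s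
  several-branching {x} {y} x≢y two-x two-y with side x Bool.≟ side y
  ... | yes same = same-side x≢y same two-x two-y
  ... | no x≁y with any? (λ z → ¬? (z ≟ x) ×-dec ¬? (z ≟ y) ×-dec twoNeighbours? G z)
  ...   | no none = exactly-two x≢y two-x two-y λ z z≢x z≢y two-z → none (z , z≢x , z≢y , two-z)
  ...   | yes (z , z≢x , z≢y , two-z) with side z Bool.≟ side x
  ...     | yes z∼x = same-side z≢x z∼x two-z two-x
  ...     | no z≁x  = same-side z≢y (trans (¬-not z≁x) (sym (¬-not (≢-sym x≁y)))) two-z two-y

  classify : Outcome G s
  classify with any? (twoNeighbours? G)
  ... | no none = no-branching λ v two → none (v , two)
  ... | yes (x , two-x) with any? (λ y → ¬? (y ≟ x) ×-dec twoNeighbours? G y)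
  ...   | no only-x               = one-branching two-x λ v v≢x two → only-x (v , v≢x , two)
  ...   | yes (y , y≢x , two-y) = several-branching (≢-sym y≢x) two-x two-y

mainTheorem4 : ∀ (n : ℕ) (G : Graph n) → 0 < n → Connected G → Bipartite G →
    ∀ (s : ℕ) → IsSudokuNumber G 3 s →
      (pendantCount G ≤ s × s ≤ n)
      × (s ≡ n ⇔ (Iso G (complete 1) ⊎ Iso G (complete 2)))
      × (s ≡ n ∸ 1 ⇔ ((Σ ℕ λ r → r ≥ 2 × Iso G (star r)) ⊎ Iso G P4))
mainTheorem4 zero    _ () _ _ _ _
mainTheorem4 (suc r) G _ conn (side , bip) s sn =
  (pendantCount≤s , s≤n) , outcome-characterises (s≤s z≤n) classify
  where open Classification G conn side bip sn
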